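{- Let $1\le q<q+\ell\le n$, $\mathbb{P}=\mathrm{MC}(n,q)$, $\mathbb{Q}=\mathrm{MC}(n,q+\ell)$. If $\alpha\subseteq\binom{[n]}2$ is a connected edge set with $|\alpha|\ge1$, then \[0\le\mathbb{E}_{\mathbb{P}}[Y^\alpha]-\mathbb{E}_{\mathbb{Q}}[Y^\alpha]\le\frac{\ell}{q^{|V(\alpha)|}}\,(|V(\alpha)|-1).\]
   Context: Graphs on $[n]$ are encoded as $Y\in\{\pm1\}^{\binom n2}$ ($+1$ = edge present), and $Y^\alpha=\prod_{e\in\alpha}Y_e$. $\mathrm{MC}(n,m)$: each vertex independently gets a uniform label in $[m]$; same-label vertices are always connected, different-label vertices are connected independently with probability $1/2$. $V(\alpha)$ is the set of vertices incident to at least one edge of $\alpha$; $\alpha$ connected means the graph $(V(\alpha),\alpha)$ is connected. -}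

module Defs where

open import Data.Bool using (Bool; true; false; if_then_else_; _∧_; _∨_)
open import Data.Nat as ℕ using (ℕ; zero; suc)
open import Data.Fin using (Fin; _<_)
open import Data.Fin.Properties using (_≟_; _<?_)
open import Data.Fin.Subset using (Subset; _∈_)
open import Data.List as List using (List; []; _∷_; map; concatMap; filter; length; lookup; allFin; foldr)
open import Data.Bool.ListAction using (any)
open import Data.Vec as Vec using (Vec; tabulate)
open import Data.Product using (_×_; _,_; proj₁; proj₂)
open import Data.Sum using (_⊎_)
open import Data.Integer using (+_)
open import Data.Rational as ℚ using (ℚ; 0ℚ; 1ℚ; ½; -_; _+_; _*_; _/_)
open import Relation.Nullary.Decidable using (⌊_⌋)
open import Relation.Binary.PropositionalEquality using (_≡_)

-- All unordered pairs {i,j} of [n], encoded as ordered (i , j) with i < j.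
pairs : (n : ℕ) → List (Fin n × Fin n)
pairs n = filter (λ p → proj₁ p <? proj₂ p)
                 (concatMap (λ i → map (λ j → (i , j)) (allFin n)) (allFin n))

E : ℕ → ℕ
E n = length (pairs n)

edge : (n : ℕ) → Fin (E n) → Fin n × Fin n
edge n k = lookup (pairs n) k

-- Graphs Y ∈ {±1}^(binom n 2): true ↔ +1 (edge present), false ↔ -1
Graph : ℕ → Set
Graph n = Vec Bool (E n)

EdgeSet : ℕ → Set
EdgeSet n = Subset (E n)

sumℚ : List ℚ → ℚ
sumℚ = foldr _+_ 0ℚ

prodℚ : List ℚ → ℚ
prodℚ = foldr _*_ 1ℚ

mono : {n : ℕ} → EdgeSet n → Graph n → ℚ
mono {n} α Y = prodℚ (map (λ k → if Vec.lookup α k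
                                   then (if Vec.lookup Y k then 1ℚ else - 1ℚ)
                                   else 1ℚ) (allFin (E n)))

allVecs : {A : Set} → List A → (n : ℕ) → List (Vec A n)
allVecs xs zero = Vec.[] ∷ []
allVecs xs (suc n) = concatMap (λ x → map (x Vec.∷_) (allVecs xs n)) xs

allGraphs : (n : ℕ) → List (Graph n)
allGraphs n = allVecs (true ∷ false ∷ []) (E n)

powℚ : ℚ → ℕ → ℚ
powℚ x zero = 1ℚ
powℚ x (suc k) = x * powℚ x k

-- (1/m)^k  (with the harmless convention 0 when m = 0)
invPow : ℕ → ℕ → ℚ
invPow zero k = 0ℚ
invPow (suc m) k = powℚ ((+ 1) / suc m) k

condProb : {n m : ℕ} → Vec (Fin m) n → Graph n → ℚ
condProb {n} σ Y = prodℚ (map w (allFin (E n)))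
  where
  w : Fin (E n) → ℚ
  w k = if ⌊ Vec.lookup σ (proj₁ (edge n k)) ≟ Vec.lookup σ (proj₂ (edge n k)) ⌋
        then (if Vec.lookup Y k then 1ℚ else 0ℚ)
        else ½

-- E_{MC(n,m)}[f(Y)]: labels uniform in [m]^n, then Y given labels as above
Expect : (n m : ℕ) → (Graph n → ℚ) → ℚ
Expect n m f = sumℚ (map (λ σ → sumℚ (map (λ Y → invPow m n * condProb σ Y * f Y)
                                            (allGraphs n)))
                         (allVecs (allFin m) n))

V : {n : ℕ} → EdgeSet n → Subset n
V {n} α = tabulate (λ v → any (λ k → Vec.lookup α k ∧
                                  (⌊ proj₁ (edge n k) ≟ v ⌋ ∨ ⌊ proj₂ (edge n k) ≟ v ⌋))
                              (allFin (E n)))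

data Reach {n : ℕ} (α : EdgeSet n) : Fin n → Fin n → Set where
  here : ∀ {u} → Reach α u u
  step : ∀ {u w v : Fin n} (k : Fin (E n)) → _∈_ {n = E n} k α →
         ((edge n k ≡ (u , w)) ⊎ (edge n k ≡ (w , u))) →
         Reach α w v → Reach α u v

Connected : {n : ℕ} → EdgeSet n → Set
Connected {n} α = ∀ (u v : Fin n) → u ∈ V {n} α → v ∈ V {n} α → Reach {n} α u v

{-# OPTIONS --safe #-}
-- Given the labels σ, the pairs of Y are independent; a pair with equal labels is always an edge and
-- a pair with distinct labels has E[Y_e] = 0.  Hence E[Y^α | σ] is 1 if every edge of α is
-- monochromatic and 0 otherwise.  As α is connected this happens iff σ is constant on V(α), an event
-- of probability m^(1-|V(α)|).  With a = 1/q, b = 1/(q+ℓ) and j = |V(α)| - 1 the difference is thus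
-- a^j - b^j, and a^(j+1) - b^(j+1) = a (a^j - b^j) + b^j (a - b) together with a - b = ℓab ≤ ℓa²
-- gives 0 ≤ a^j - b^j ≤ ℓ j a^(j+1) by induction on j.
module Submission where

open import Defs

module RationalPowers where

  open import Data.Nat as ℕ using (ℕ; zero; suc)
  open import Data.Nat.Coprimality using (1-coprimeTo) renaming (sym to coprime-sym)
  open import Data.Integer as ℤ using (+_)
  import Data.Integer.Properties as ℤ
  open import Data.Product using (_×_; _,_)
  open import Data.Rational
    using (ℚ; 0ℚ; 1ℚ; mkℚ; _/_; _+_; _-_; -_; _*_; _≤_; 1/_; nonNegative)
  open import Data.Rational.Properties
  open import Data.Rational.Solver using (module +-*-Solver)
  open import Relation.Binary.PropositionalEquality
  open +-*-Solver

  fromℕ : ℕ → ℚ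
  fromℕ n = + n / 1

  1/suc : ℕ → ℚ
  1/suc m = + 1 / suc m

  private
    fromℕ≡mkℚ : ∀ n → fromℕ n ≡ mkℚ (+ n) 0 (coprime-sym (1-coprimeTo n))
    fromℕ≡mkℚ n = ↥p/↧p≡p (mkℚ (+ n) 0 (coprime-sym (1-coprimeTo n)))

  fromℕ-+ : ∀ m n → fromℕ (m ℕ.+ n) ≡ fromℕ m + fromℕ n
  fromℕ-+ m n rewrite fromℕ≡mkℚ m | fromℕ≡mkℚ n =
    /-cong (cong₂ ℤ._+_ (sym (ℤ.*-identityʳ (+ m))) (sym (ℤ.*-identityʳ (+ n)))) refl

  fromℕ-* : ∀ m n → fromℕ (m ℕ.* n) ≡ fromℕ m * fromℕ n
  fromℕ-* m n rewrite fromℕ≡mkℚ m | fromℕ≡mkℚ n = /-cong (ℤ.pos-* m n) refl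

  1/suc-inverseˡ : ∀ m → 1/suc m * fromℕ (suc m) ≡ 1ℚ
  1/suc-inverseˡ m rewrite fromℕ≡mkℚ (suc m) =
    trans (cong (_* p) (↥p/↧p≡p (1/ p))) (*-inverseˡ p)
    where p = mkℚ (+ suc m) 0 (coprime-sym (1-coprimeTo (suc m)))

  1/suc-nonNeg : ∀ m → 0ℚ ≤ 1/suc m
  1/suc-nonNeg m = nonNegative⁻¹ (1/suc m) {{normalize-nonNeg 1 (suc m)}}

  fromℕ-nonNeg : ∀ n → 0ℚ ≤ fromℕ n
  fromℕ-nonNeg n = nonNegative⁻¹ (fromℕ n) {{normalize-nonNeg n 1}}

  private
    *-monoˡ-≤-0≤ : ∀ {p q} r → 0ℚ ≤ r → p ≤ q → r * p ≤ r * q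
    *-monoˡ-≤-0≤ r 0≤r = *-monoˡ-≤-nonNeg r {{nonNegative 0≤r}}

    *-monoʳ-≤-0≤ : ∀ {p q} r → 0ℚ ≤ r → p ≤ q → p * r ≤ q * r
    *-monoʳ-≤-0≤ r 0≤r = *-monoʳ-≤-nonNeg r {{nonNegative 0≤r}}

    0≤* : ∀ {p q} → 0ℚ ≤ p → 0ℚ ≤ q → 0ℚ ≤ p * q
    0≤* {p} 0≤p 0≤q = ≤-trans (≤-reflexive (sym (*-zeroʳ p))) (*-monoˡ-≤-0≤ p 0≤p 0≤q)

  p≤q⇒0≤q-p : ∀ {p q} → p ≤ q → 0ℚ ≤ q - p
  p≤q⇒0≤q-p {p} p≤q = ≤-trans (≤-reflexive (sym (+-inverseʳ p))) (+-monoˡ-≤ (- p) p≤q)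

  0≤q-p⇒p≤q : ∀ {p q} → 0ℚ ≤ q - p → p ≤ q
  0≤q-p⇒p≤q {p} {q} 0≤q-p = begin
    p           ≡⟨ sym (+-identityʳ p) ⟩
    p + 0ℚ      ≤⟨ +-monoʳ-≤ p 0≤q-p ⟩
    p + (q - p) ≡⟨ solve 2 (λ p q → p :+ (q :- p) := q) refl p q ⟩
    q           ∎
    where open ≤-Reasoning

  powℚ-nonNeg : ∀ {a} → 0ℚ ≤ a → ∀ j → 0ℚ ≤ powℚ a j
  powℚ-nonNeg 0≤a zero    = nonNegative⁻¹ 1ℚ
  powℚ-nonNeg 0≤a (suc j) = 0≤* 0≤a (powℚ-nonNeg 0≤a j)

  module _ {a b : ℚ} (0≤b : 0ℚ ≤ b) (b≤a : b ≤ a) where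

    private
      0≤a : 0ℚ ≤ a
      0≤a = ≤-trans 0≤b b≤a

    powℚ-mono-≤ : ∀ j → powℚ b j ≤ powℚ a j
    powℚ-mono-≤ zero    = ≤-refl
    powℚ-mono-≤ (suc j) = ≤-trans (*-monoʳ-≤-0≤ (powℚ b j) (powℚ-nonNeg 0≤b j) b≤a)
                                  (*-monoˡ-≤-0≤ a 0≤a (powℚ-mono-≤ j))

    powℚ-sub-nonNeg : ∀ j → 0ℚ ≤ powℚ a j - powℚ b j
    powℚ-sub-nonNeg j = p≤q⇒0≤q-p (powℚ-mono-≤ j)

    powℚ-sub-≤ : ∀ {d} → a - b ≤ d * a → ∀ j → powℚ a j - powℚ b j ≤ fromℕ j * d * powℚ a j
    powℚ-sub-≤ {d} a-b≤da zero = ≤-reflexive (begin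
      1ℚ - 1ℚ           ≡⟨ +-inverseʳ 1ℚ ⟩
      0ℚ                ≡⟨ sym (*-zeroˡ 1ℚ) ⟩
      0ℚ * 1ℚ           ≡⟨ cong (_* 1ℚ) (sym (*-zeroˡ d)) ⟩
      fromℕ 0 * d * 1ℚ  ∎)
      where open ≡-Reasoning
    powℚ-sub-≤ {d} a-b≤da (suc j) = begin
      a * A - b * B                       ≡⟨ solve 4 (λ a b A B → a :* A :- b :* B := a :* (A :- B) :+ B :* (a :- b)) refl a b A B ⟩
      a * (A - B) + B * (a - b)           ≤⟨ +-mono-≤ (*-monoˡ-≤-0≤ a 0≤a (powℚ-sub-≤ a-b≤da j))
                                                      (≤-trans (*-monoʳ-≤-0≤ (a - b) (p≤q⇒0≤q-p b≤a) (powℚ-mono-≤ j))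
                                                               (*-monoˡ-≤-0≤ A (powℚ-nonNeg 0≤a j) a-b≤da)) ⟩
      a * (fromℕ j * d * A) + A * (d * a) ≡⟨ solve 4 (λ a A d J → a :* (J :* d :* A) :+ A :* (d :* a) := (con 1ℚ :+ J) :* d :* (a :* A)) refl a A d (fromℕ j) ⟩
      (1ℚ + fromℕ j) * d * (a * A)        ≡⟨ cong (λ x → x * d * (a * A)) (sym (fromℕ-+ 1 j)) ⟩
      fromℕ (suc j) * d * (a * A)         ∎
      where
      open ≤-Reasoning
      A B : ℚ
      A = powℚ a j
      B = powℚ b j

  1/suc-sub : ∀ q ℓ → 1/suc q - 1/suc (q ℕ.+ ℓ) ≡ fromℕ ℓ * 1/suc q * 1/suc (q ℕ.+ ℓ)
  1/suc-sub q ℓ = begin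
    a - b                       ≡⟨ cong₂ _-_ (sym (trans (cong (a *_) b[Q+L]≡1) (*-identityʳ a)))
                                             (sym (trans (cong (b *_) (1/suc-inverseˡ q)) (*-identityʳ b))) ⟩
    a * (b * (Q + L)) - b * (a * Q) ≡⟨ solve 4 (λ a b Q L → a :* (b :* (Q :+ L)) :- b :* (a :* Q) := L :* a :* b) refl a b Q L ⟩
    L * a * b                   ∎
    where
    open ≡-Reasoning
    a b Q L : ℚ
    a = 1/suc q
    b = 1/suc (q ℕ.+ ℓ)
    Q = fromℕ (suc q)
    L = fromℕ ℓ
    b[Q+L]≡1 : b * (Q + L) ≡ 1ℚ
    b[Q+L]≡1 = trans (cong (b *_) (sym (fromℕ-+ (suc q) ℓ))) (1/suc-inverseˡ (q ℕ.+ ℓ))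

  invPow-sub-bounds : ∀ q ℓ k .{{_ : ℕ.NonZero k}} →
      (0ℚ ≤ invPow (suc q) (k ℕ.∸ 1) - invPow (suc (q ℕ.+ ℓ)) (k ℕ.∸ 1))
    × (invPow (suc q) (k ℕ.∸ 1) - invPow (suc (q ℕ.+ ℓ)) (k ℕ.∸ 1) ≤ fromℕ (ℓ ℕ.* (k ℕ.∸ 1)) * invPow (suc q) k)
  invPow-sub-bounds q ℓ (suc j) =
    powℚ-sub-nonNeg 0≤b b≤a j ,
    ≤-trans (powℚ-sub-≤ 0≤b b≤a a-b≤La*a j) (≤-reflexive (begin
      fromℕ j * (L * a) * powℚ a j     ≡⟨ solve 4 (λ J L a A → J :* (L :* a) :* A := L :* J :* (a :* A)) refl (fromℕ j) L a (powℚ a j) ⟩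
      L * fromℕ j * (a * powℚ a j)     ≡⟨ cong (_* (a * powℚ a j)) (sym (fromℕ-* ℓ j)) ⟩
      fromℕ (ℓ ℕ.* j) * powℚ a (suc j) ∎))
    where
    open ≡-Reasoning
    a b L : ℚ
    a = 1/suc q
    b = 1/suc (q ℕ.+ ℓ)
    L = fromℕ ℓ
    0≤b : 0ℚ ≤ b
    0≤b = 1/suc-nonNeg (q ℕ.+ ℓ)
    0≤La : 0ℚ ≤ L * a
    0≤La = 0≤* (fromℕ-nonNeg ℓ) (1/suc-nonNeg q)
    b≤a : b ≤ a
    b≤a = 0≤q-p⇒p≤q (subst (0ℚ ≤_) (sym (1/suc-sub q ℓ)) (0≤* 0≤La 0≤b))
    a-b≤La*a : a - b ≤ L * a * a
    a-b≤La*a = subst (_≤ L * a * a) (sym (1/suc-sub q ℓ)) (*-monoˡ-≤-0≤ (L * a) 0≤La b≤a)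

  fromℕ-*-invPow : ∀ m k .{{_ : ℕ.NonZero k}} → fromℕ (suc m) * invPow (suc m) k ≡ invPow (suc m) (k ℕ.∸ 1)
  fromℕ-*-invPow m (suc j) = begin
    Q * (a * powℚ a j) ≡⟨ sym (*-assoc Q a (powℚ a j)) ⟩
    Q * a * powℚ a j   ≡⟨ cong (_* powℚ a j) (trans (*-comm Q a) (1/suc-inverseˡ m)) ⟩
    1ℚ * powℚ a j      ≡⟨ *-identityˡ (powℚ a j) ⟩
    powℚ a j           ∎
    where
    open ≡-Reasoning
    a Q : ℚ
    a = 1/suc m
    Q = fromℕ (suc m)

module FiniteSums where

  open import Data.Nat using (zero; suc)
  open import Data.Fin using (Fin; zero; suc)
  open import Data.Fin.Properties using (suc-injective)
  open import Data.List using (List; []; _∷_; map; concatMap; _++_; allFin)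
  open import Data.List.Properties using (map-++; map-cong; map-∘; map-tabulate)
  open import Data.Vec as Vec using (Vec)
  open import Data.Rational using (ℚ; 0ℚ; 1ℚ; _+_; _*_)
  open import Data.Rational.Properties
  open import Data.Rational.Solver using (module +-*-Solver)
  open import Function using (_∘_)
  open import Relation.Nullary using (¬_)
  open import Relation.Binary.PropositionalEquality
  open +-*-Solver
  open RationalPowers using (fromℕ; fromℕ-+)

  private
    variable
      A B : Set

  sumℚ-++ : ∀ (xs ys : List ℚ) → sumℚ (xs ++ ys) ≡ sumℚ xs + sumℚ ys
  sumℚ-++ []       ys = sym (+-identityˡ _)
  sumℚ-++ (x ∷ xs) ys = trans (cong (x +_) (sumℚ-++ xs ys)) (sym (+-assoc x _ _))

  sumℚ-concatMap : ∀ (f : B → ℚ) (g : A → List B) xs →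
    sumℚ (map f (concatMap g xs)) ≡ sumℚ (map (λ x → sumℚ (map f (g x))) xs)
  sumℚ-concatMap f g []       = refl
  sumℚ-concatMap f g (x ∷ xs) = begin
    sumℚ (map f (g x ++ concatMap g xs))             ≡⟨ cong sumℚ (map-++ f (g x) (concatMap g xs)) ⟩
    sumℚ (map f (g x) ++ map f (concatMap g xs))     ≡⟨ sumℚ-++ (map f (g x)) _ ⟩
    sumℚ (map f (g x)) + sumℚ (map f (concatMap g xs)) ≡⟨ cong (sumℚ (map f (g x)) +_) (sumℚ-concatMap f g xs) ⟩
    _                                                ∎
    where open ≡-Reasoning

  sumℚ-cong : ∀ {f g : A → ℚ} → (∀ x → f x ≡ g x) → ∀ xs → sumℚ (map f xs) ≡ sumℚ (map g xs)
  sumℚ-cong f≗g xs = cong sumℚ (map-cong f≗g xs)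

  prodℚ-cong : ∀ {f g : A → ℚ} → (∀ x → f x ≡ g x) → ∀ xs → prodℚ (map f xs) ≡ prodℚ (map g xs)
  prodℚ-cong f≗g xs = cong prodℚ (map-cong f≗g xs)

  sumℚ-*ˡ : ∀ c (f : A → ℚ) xs → sumℚ (map (λ x → c * f x) xs) ≡ c * sumℚ (map f xs)
  sumℚ-*ˡ c f []       = sym (*-zeroʳ c)
  sumℚ-*ˡ c f (x ∷ xs) = trans (cong (c * f x +_) (sumℚ-*ˡ c f xs)) (sym (*-distribˡ-+ c (f x) _))

  sumℚ-*ʳ : ∀ c (f : A → ℚ) xs → sumℚ (map (λ x → f x * c) xs) ≡ sumℚ (map f xs) * c
  sumℚ-*ʳ c f xs = trans (sumℚ-cong (λ x → *-comm (f x) c) xs) (trans (sumℚ-*ˡ c f xs) (*-comm c _))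

  sumℚ-+ : ∀ (f g : A → ℚ) xs → sumℚ (map (λ x → f x + g x) xs) ≡ sumℚ (map f xs) + sumℚ (map g xs)
  sumℚ-+ f g []       = refl
  sumℚ-+ f g (x ∷ xs) rewrite sumℚ-+ f g xs =
    solve 4 (λ a b c d → (a :+ b) :+ (c :+ d) := (a :+ c) :+ (b :+ d)) refl (f x) (g x) (sumℚ (map f xs)) (sumℚ (map g xs))

  sumℚ-zero : ∀ (xs : List A) → sumℚ (map (λ _ → 0ℚ) xs) ≡ 0ℚ
  sumℚ-zero []       = refl
  sumℚ-zero (x ∷ xs) = trans (+-identityˡ _) (sumℚ-zero xs)

  sumℚ-comm : ∀ (f : A → B → ℚ) xs ys →
    sumℚ (map (λ x → sumℚ (map (f x) ys)) xs) ≡ sumℚ (map (λ y → sumℚ (map (λ x → f x y) xs)) ys)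
  sumℚ-comm f []       ys = sym (sumℚ-zero ys)
  sumℚ-comm f (x ∷ xs) ys = trans (cong (sumℚ (map (f x) ys) +_) (sumℚ-comm f xs ys))
                                  (sym (sumℚ-+ (f x) (λ y → sumℚ (map (λ x → f x y) xs)) ys))

  prodℚ-* : ∀ (f g : A → ℚ) xs → prodℚ (map f xs) * prodℚ (map g xs) ≡ prodℚ (map (λ x → f x * g x) xs)
  prodℚ-* f g []       = refl
  prodℚ-* f g (x ∷ xs) rewrite sym (prodℚ-* f g xs) =
    solve 4 (λ a b c d → (a :* c) :* (b :* d) := (a :* b) :* (c :* d)) refl (f x) (g x) (prodℚ (map f xs)) (prodℚ (map g xs))

  map-allFin-suc : ∀ {n} (h : Fin (suc n) → A) → map h (allFin (suc n)) ≡ h zero ∷ map (h ∘ suc) (allFin n)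
  map-allFin-suc h = cong (h zero ∷_) (trans (map-tabulate suc h) (sym (map-tabulate (λ i → i) (h ∘ suc))))

  sumℚ-allVecs-prodℚ : ∀ (xs : List A) n (F : Fin n → A → ℚ) →
    sumℚ (map (λ σ → prodℚ (map (λ k → F k (Vec.lookup σ k)) (allFin n))) (allVecs xs n))
    ≡ prodℚ (map (λ k → sumℚ (map (F k) xs)) (allFin n))
  sumℚ-allVecs-prodℚ xs zero    F = refl
  sumℚ-allVecs-prodℚ {A = A} xs (suc n) F = begin
    sumℚ (map Π (concatMap (λ x → map (x Vec.∷_) (allVecs xs n)) xs))
      ≡⟨ sumℚ-concatMap Π _ xs ⟩
    sumℚ (map (λ x → sumℚ (map Π (map (x Vec.∷_) (allVecs xs n)))) xs)
      ≡⟨ sumℚ-cong (λ x → trans (cong sumℚ (sym (map-∘ (allVecs xs n))))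
                                (sumℚ-cong (λ σ → cong prodℚ (map-allFin-suc (λ k → F k (Vec.lookup (x Vec.∷ σ) k)))) (allVecs xs n))) xs ⟩
    sumℚ (map (λ x → sumℚ (map (λ σ → F zero x * Πₛ σ) (allVecs xs n))) xs)
      ≡⟨ sumℚ-cong (λ x → trans (sumℚ-*ˡ (F zero x) Πₛ (allVecs xs n))
                                (cong (F zero x *_) (sumℚ-allVecs-prodℚ xs n (F ∘ suc)))) xs ⟩
    sumℚ (map (λ x → F zero x * Πₛ-sums) xs)
      ≡⟨ sumℚ-*ʳ Πₛ-sums (F zero) xs ⟩
    sumℚ (map (F zero) xs) * Πₛ-sums
      ≡⟨ cong prodℚ (sym (map-allFin-suc (λ k → sumℚ (map (F k) xs)))) ⟩
    prodℚ (map (λ k → sumℚ (map (F k) xs)) (allFin (suc n))) ∎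
    where
    open ≡-Reasoning
    Π : Vec A (suc n) → ℚ
    Π σ = prodℚ (map (λ k → F k (Vec.lookup σ k)) (allFin (suc n)))
    Πₛ : Vec A n → ℚ
    Πₛ σ = prodℚ (map (λ k → F (suc k) (Vec.lookup σ k)) (allFin n))
    Πₛ-sums : ℚ
    Πₛ-sums = prodℚ (map (λ k → sumℚ (map (F (suc k)) xs)) (allFin n))

  powℚ≡prodℚ : ∀ x n → powℚ x n ≡ prodℚ (map (λ _ → x) (allFin n))
  powℚ≡prodℚ x zero    = refl
  powℚ≡prodℚ x (suc n) = trans (cong (x *_) (powℚ≡prodℚ x n)) (cong prodℚ (sym (map-allFin-suc {n = n} (λ _ → x))))

  sumℚ-delta : ∀ {n} (f : Fin n → ℚ) c → (∀ x → ¬ x ≡ c → f x ≡ 0ℚ) → sumℚ (map f (allFin n)) ≡ f c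
  sumℚ-delta {suc n} f zero f≡0 = begin
    sumℚ (map f (allFin (suc n)))           ≡⟨ cong sumℚ (map-allFin-suc f) ⟩
    f zero + sumℚ (map (f ∘ suc) (allFin n)) ≡⟨ cong (f zero +_) (trans (sumℚ-cong (λ x → f≡0 (suc x) (λ ())) (allFin n)) (sumℚ-zero (allFin n))) ⟩
    f zero + 0ℚ                             ≡⟨ +-identityʳ (f zero) ⟩
    f zero                                  ∎
    where open ≡-Reasoning
  sumℚ-delta {suc n} f (suc c) f≡0 = begin
    sumℚ (map f (allFin (suc n)))           ≡⟨ cong sumℚ (map-allFin-suc f) ⟩
    f zero + sumℚ (map (f ∘ suc) (allFin n)) ≡⟨ cong₂ _+_ (f≡0 zero (λ ())) (sumℚ-delta (f ∘ suc) c (λ x x≢c → f≡0 (suc x) (x≢c ∘ suc-injective))) ⟩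
    0ℚ + f (suc c)                          ≡⟨ +-identityˡ (f (suc c)) ⟩
    f (suc c)                               ∎
    where open ≡-Reasoning

  sumℚ-const : ∀ n x → sumℚ (map (λ _ → x) (allFin n)) ≡ fromℕ n * x
  sumℚ-const zero    x = sym (*-zeroˡ x)
  sumℚ-const (suc n) x = begin
    sumℚ (map (λ _ → x) (allFin (suc n))) ≡⟨ cong sumℚ (map-allFin-suc {n = n} (λ _ → x)) ⟩
    x + sumℚ (map (λ _ → x) (allFin n))   ≡⟨ cong (x +_) (sumℚ-const n x) ⟩
    x + fromℕ n * x                       ≡⟨ solve 2 (λ x N → x :+ N :* x := (con 1ℚ :+ N) :* x) refl x (fromℕ n) ⟩
    (1ℚ + fromℕ n) * x                    ≡⟨ cong (_* x) (sym (fromℕ-+ 1 n)) ⟩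
    fromℕ (suc n) * x                     ∎
    where open ≡-Reasoning

module Moments where

  open import Data.Nat as ℕ using (ℕ; suc; _∸_; NonZero)
  open import Data.Fin using (Fin)
  open import Data.Fin.Properties using (_≟_)
  open import Data.Fin.Subset using (Subset; _∈_; ∣_∣; inside; outside; Nonempty)
  open import Data.Fin.Subset.Properties using (nonempty?; Empty-unique; ∣⊥∣≡0)
  open import Data.Bool using (Bool; true; false; if_then_else_; not; _∧_; _∨_; T)
  open import Data.Bool.Properties using (T-≡; T-∧; T-∨)
  open import Data.Bool.ListAction using (all)
  open import Data.List using (List; []; _∷_; map; allFin)
  open import Data.List.Membership.Propositional using (lose)
  open import Data.List.Membership.Propositional.Properties using (∈-allFin)
  import Data.List.Relation.Unary.All as All
  open import Data.List.Relation.Unary.All.Properties using (all⁺; all⁻; tabulate⁺)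
  open import Data.List.Relation.Unary.Any.Properties using (any⁺)
  open import Data.Vec using (Vec; lookup; _∷_; []; here; there)
  open import Data.Vec.Properties using (lookup∘tabulate; []=⇒lookup; lookup⇒[]=)
  open import Data.Product using (_×_; _,_; proj₁; proj₂)
  open import Data.Sum using (_⊎_; inj₁; inj₂) renaming (map to map-⊎)
  open import Data.Rational using (ℚ; 0ℚ; 1ℚ; ½; -_; _*_)
  open import Data.Rational.Properties using (*-assoc; *-comm; *-zeroˡ; *-zeroʳ; *-identityˡ; *-identityʳ)
  open import Data.Empty using (⊥-elim)
  open import Function using (_∘_; _⇔_; mk⇔; Equivalence)
  open import Relation.Nullary using (¬_; yes; no; contradiction)
  open import Relation.Nullary.Decidable using (⌊_⌋; toWitness; fromWitness)
  open import Relation.Binary.PropositionalEquality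
  open RationalPowers using (fromℕ; 1/suc; 1/suc-inverseˡ; fromℕ-*-invPow)
  open FiniteSums
  open Equivalence using (to; from)

  private
    variable
      A : Set
      n m : ℕ

  indicator : Bool → ℚ
  indicator b = if b then 1ℚ else 0ℚ

  prodℚ-indicator : ∀ (p : A → Bool) xs → prodℚ (map (indicator ∘ p) xs) ≡ indicator (all p xs)
  prodℚ-indicator p []       = refl
  prodℚ-indicator p (x ∷ xs) with p x
  ... | true  = trans (*-identityˡ (prodℚ (map (indicator ∘ p) xs))) (prodℚ-indicator p xs)
  ... | false = *-zeroˡ (prodℚ (map (indicator ∘ p) xs))

  T-all-allFin : ∀ (p : Fin n → Bool) → T (all p (allFin n)) ⇔ (∀ i → T (p i))
  T-all-allFin {n} p = mk⇔ (λ Tall i → All.lookup (all⁺ p (allFin n) Tall) (∈-allFin i))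
                       (λ Tp → all⁻ p (tabulate⁺ Tp))

  T-not-∨ : ∀ {x y} → T (not x ∨ y) ⇔ (T x → T y)
  T-not-∨ {true}  = mk⇔ (λ Ty _ → Ty) (λ f → f _)
  T-not-∨ {false} = mk⇔ (λ _ ()) (λ _ → _)

  T-injective : ∀ {x y} → T x ⇔ T y → x ≡ y
  T-injective {false} {false} _     = refl
  T-injective {false} {true}  Tx⇔Ty = ⊥-elim (from Tx⇔Ty _)
  T-injective {true}  {false} Tx⇔Ty = ⊥-elim (to Tx⇔Ty _)
  T-injective {true}  {true}  _     = refl

  ∈⇔T-lookup : ∀ {S : Subset n} {i} → i ∈ S ⇔ T (lookup S i)
  ∈⇔T-lookup {S = S} {i} = mk⇔ (λ i∈S → from T-≡ ([]=⇒lookup i∈S)) (λ TSi → lookup⇒[]= i S (to T-≡ TSi))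

  labellings : (n m : ℕ) → List (Vec (Fin m) n)
  labellings n m = allVecs (allFin m) n

  sameLabel : Vec (Fin m) n → Fin (E n) → Bool
  sameLabel {n = n} σ k = ⌊ lookup σ (proj₁ (edge n k)) ≟ lookup σ (proj₂ (edge n k)) ⌋

  monochromatic : Vec (Fin m) n → EdgeSet n → Bool
  monochromatic {n = n} σ α = all (λ k → not (lookup α k) ∨ sameLabel σ k) (allFin (E n))

  private
    pairWeight : (same inα y : Bool) → ℚ
    pairWeight same inα y = (if same then indicator y else ½) * (if inα then (if y then 1ℚ else - 1ℚ) else 1ℚ)

    pairWeight-sum : ∀ same inα → sumℚ (map (pairWeight same inα) (true ∷ false ∷ [])) ≡ indicator (not inα ∨ same)
    pairWeight-sum true  true  = refl
    pairWeight-sum true  false = refl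
    pairWeight-sum false true  = refl
    pairWeight-sum false false = refl

  sumℚ-condProb-mono : ∀ (σ : Vec (Fin m) n) α →
    sumℚ (map (λ Y → condProb σ Y * mono {n} α Y) (allGraphs n)) ≡ indicator (monochromatic σ α)
  sumℚ-condProb-mono {n = n} σ α = begin
    sumℚ (map (λ Y → condProb σ Y * mono {n} α Y) (allGraphs n))
      ≡⟨ sumℚ-cong (λ Y → prodℚ-* _ _ (allFin (E n))) (allGraphs n) ⟩
    sumℚ (map (λ Y → prodℚ (map (λ k → w k (lookup Y k)) (allFin (E n)))) (allGraphs n))
      ≡⟨ sumℚ-allVecs-prodℚ (true ∷ false ∷ []) (E n) w ⟩
    prodℚ (map (λ k → sumℚ (map (w k) (true ∷ false ∷ []))) (allFin (E n)))
      ≡⟨ prodℚ-cong (λ k → pairWeight-sum (sameLabel σ k) (lookup α k)) (allFin (E n)) ⟩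
    prodℚ (map (λ k → indicator (not (lookup α k) ∨ sameLabel σ k)) (allFin (E n)))
      ≡⟨ prodℚ-indicator (λ k → not (lookup α k) ∨ sameLabel σ k) (allFin (E n)) ⟩
    indicator (monochromatic σ α) ∎
    where
    open ≡-Reasoning
    w : Fin (E n) → Bool → ℚ
    w k = pairWeight (sameLabel σ k) (lookup α k)

  constantOn : Vec (Fin m) n → Subset n → Fin m → Bool
  constantOn {n = n} σ S c = all (λ i → not (lookup S i) ∨ ⌊ lookup σ i ≟ c ⌋) (allFin n)

  constantOn⇔ : ∀ (σ : Vec (Fin m) n) S c → T (constantOn σ S c) ⇔ (∀ i → i ∈ S → lookup σ i ≡ c)
  constantOn⇔ σ S c = mk⇔
    (λ Tc i i∈S → toWitness (to T-not-∨ (to (T-all-allFin _) Tc i) (to ∈⇔T-lookup i∈S)))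
    (λ σ≡c → from (T-all-allFin _) (λ i → from T-not-∨ (λ TSi → fromWitness (σ≡c i (from ∈⇔T-lookup TSi)))))

  prodℚ-Subset : ∀ a (S : Subset n) → prodℚ (map (λ i → if lookup S i then a else 1ℚ) (allFin n)) ≡ powℚ a ∣ S ∣
  prodℚ-Subset a []           = refl
  prodℚ-Subset a (true ∷ S)   = trans (cong prodℚ (map-allFin-suc (λ i → if lookup (true ∷ S) i then a else 1ℚ)))
                                      (cong (a *_) (prodℚ-Subset a S))
  prodℚ-Subset a (false ∷ S)  = trans (cong prodℚ (map-allFin-suc (λ i → if lookup (false ∷ S) i then a else 1ℚ)))
                                      (trans (*-identityˡ _) (prodℚ-Subset a S))

  sumℚ-label-≟ : ∀ m (c : Fin (suc m)) b →
    sumℚ (map (λ x → 1/suc m * indicator (not b ∨ ⌊ x ≟ c ⌋)) (allFin (suc m))) ≡ (if b then 1/suc m else 1ℚ)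
  sumℚ-label-≟ m c false = begin
    sumℚ (map (λ _ → 1/suc m * 1ℚ) (allFin (suc m))) ≡⟨ sumℚ-const (suc m) (1/suc m * 1ℚ) ⟩
    fromℕ (suc m) * (1/suc m * 1ℚ)                  ≡⟨ cong (fromℕ (suc m) *_) (*-identityʳ (1/suc m)) ⟩
    fromℕ (suc m) * 1/suc m                         ≡⟨ *-comm (fromℕ (suc m)) (1/suc m) ⟩
    1/suc m * fromℕ (suc m)                         ≡⟨ 1/suc-inverseˡ m ⟩
    1ℚ                                              ∎
    where open ≡-Reasoning
  sumℚ-label-≟ m c true = trans (sumℚ-delta _ c vanishes) hit
    where
    hit : 1/suc m * indicator ⌊ c ≟ c ⌋ ≡ 1/suc m
    hit with c ≟ c
    ... | yes _   = *-identityʳ (1/suc m)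
    ... | no c≢c  = contradiction refl c≢c
    vanishes : ∀ x → ¬ x ≡ c → 1/suc m * indicator ⌊ x ≟ c ⌋ ≡ 0ℚ
    vanishes x x≢c with x ≟ c
    ... | yes x≡c = contradiction x≡c x≢c
    ... | no _    = *-zeroʳ (1/suc m)

  sumℚ-constantOn : ∀ m (S : Subset n) c →
    sumℚ (map (λ σ → invPow (suc m) n * indicator (constantOn σ S c)) (labellings n (suc m))) ≡ invPow (suc m) ∣ S ∣
  sumℚ-constantOn {n} m S c = begin
    sumℚ (map (λ σ → powℚ a n * indicator (constantOn σ S c)) (labellings n (suc m)))
      ≡⟨ sumℚ-cong (λ σ → trans (cong₂ _*_ (powℚ≡prodℚ a n) (sym (prodℚ-indicator (agrees σ) (allFin n))))
                                (prodℚ-* (λ _ → a) (indicator ∘ agrees σ) (allFin n))) (labellings n (suc m)) ⟩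
    sumℚ (map (λ σ → prodℚ (map (λ i → G i (lookup σ i)) (allFin n))) (labellings n (suc m)))
      ≡⟨ sumℚ-allVecs-prodℚ (allFin (suc m)) n G ⟩
    prodℚ (map (λ i → sumℚ (map (G i) (allFin (suc m)))) (allFin n))
      ≡⟨ prodℚ-cong (λ i → sumℚ-label-≟ m c (lookup S i)) (allFin n) ⟩
    prodℚ (map (λ i → if lookup S i then a else 1ℚ) (allFin n))
      ≡⟨ prodℚ-Subset a S ⟩
    powℚ a ∣ S ∣ ∎
    where
    open ≡-Reasoning
    a : ℚ
    a = 1/suc m
    agrees : Vec (Fin (suc m)) n → Fin n → Bool
    agrees σ i = not (lookup S i) ∨ ⌊ lookup σ i ≟ c ⌋
    G : Fin n → Fin (suc m) → ℚ
    G i x = a * indicator (not (lookup S i) ∨ ⌊ x ≟ c ⌋)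

  x∈p⇒∣p∣-nonZero : ∀ {x} {p : Subset n} → x ∈ p → NonZero ∣ p ∣
  x∈p⇒∣p∣-nonZero {p = inside ∷ p}  _           = _
  x∈p⇒∣p∣-nonZero {p = outside ∷ p} (there x∈p) = x∈p⇒∣p∣-nonZero x∈p

  sumℚ-constantOn-at : ∀ m (S : Subset n) {v} → v ∈ S →
    sumℚ (map (λ σ → invPow (suc m) n * indicator (constantOn σ S (lookup σ v))) (labellings n (suc m)))
    ≡ invPow (suc m) (∣ S ∣ ∸ 1)
  sumℚ-constantOn-at {n} m S {v} v∈S = begin
    sumℚ (map (λ σ → W * indicator (constantOn σ S (lookup σ v))) Σs)
      ≡⟨ sumℚ-cong (λ σ → cong (W *_) (sym (sumℚ-delta _ (lookup σ v) (other-labels σ)))) Σs ⟩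
    sumℚ (map (λ σ → W * sumℚ (map (λ c → indicator (constantOn σ S c)) Cs)) Σs)
      ≡⟨ sumℚ-cong (λ σ → sym (sumℚ-*ˡ W (λ c → indicator (constantOn σ S c)) Cs)) Σs ⟩
    sumℚ (map (λ σ → sumℚ (map (λ c → W * indicator (constantOn σ S c)) Cs)) Σs)
      ≡⟨ sumℚ-comm (λ σ c → W * indicator (constantOn σ S c)) Σs Cs ⟩
    sumℚ (map (λ c → sumℚ (map (λ σ → W * indicator (constantOn σ S c)) Σs)) Cs)
      ≡⟨ sumℚ-cong (sumℚ-constantOn m S) Cs ⟩
    sumℚ (map (λ _ → invPow (suc m) ∣ S ∣) Cs)
      ≡⟨ sumℚ-const (suc m) (invPow (suc m) ∣ S ∣) ⟩
    fromℕ (suc m) * invPow (suc m) ∣ S ∣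
      ≡⟨ fromℕ-*-invPow m ∣ S ∣ {{x∈p⇒∣p∣-nonZero v∈S}} ⟩
    invPow (suc m) (∣ S ∣ ∸ 1) ∎
    where
    open ≡-Reasoning
    W : ℚ
    W = invPow (suc m) n
    Σs : List (Vec (Fin (suc m)) n)
    Σs = labellings n (suc m)
    Cs : List (Fin (suc m))
    Cs = allFin (suc m)
    other-labels : ∀ σ c → ¬ c ≡ lookup σ v → indicator (constantOn σ S c) ≡ 0ℚ
    other-labels σ c c≢σv with constantOn σ S c in eq
    ... | true  = contradiction (sym (to (constantOn⇔ σ S c) (from T-≡ eq) v v∈S)) c≢σv
    ... | false = refl

  monochromatic⇔ : ∀ (σ : Vec (Fin m) n) α → T (monochromatic σ α) ⇔
    (∀ k → k ∈ α → lookup σ (proj₁ (edge n k)) ≡ lookup σ (proj₂ (edge n k)))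
  monochromatic⇔ σ α = mk⇔
    (λ Tm k k∈α → toWitness (to T-not-∨ (to (T-all-allFin _) Tm k) (to ∈⇔T-lookup k∈α)))
    (λ same → from (T-all-allFin _) (λ k → from T-not-∨ (λ Tαk → fromWitness (same k (from ∈⇔T-lookup Tαk)))))

  endpoint∈V : ∀ {α : EdgeSet n} {k v} → k ∈ α → proj₁ (edge n k) ≡ v ⊎ proj₂ (edge n k) ≡ v → v ∈ V {n} α
  endpoint∈V {n = n} {α = α} {k} {v} k∈α k∋v =
    from ∈⇔T-lookup (subst T (sym (lookup∘tabulate _ v)) (any⁺ incident (lose (∈-allFin k) k-incident)))
    where
    incident : Fin (E n) → Bool
    incident k′ = lookup α k′ ∧ (⌊ proj₁ (edge n k′) ≟ v ⌋ ∨ ⌊ proj₂ (edge n k′) ≟ v ⌋)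
    k-incident : T (incident k)
    k-incident = from T-∧ (to ∈⇔T-lookup k∈α , from T-∨ (map-⊎ (fromWitness {a? = _ ≟ v}) (fromWitness {a? = _ ≟ v}) k∋v))

  monochromatic-Reach : ∀ (σ : Vec (Fin m) n) {α u v} → T (monochromatic σ α) → Reach {n} α u v → lookup σ u ≡ lookup σ v
  monochromatic-Reach σ Tm here = refl
  monochromatic-Reach σ Tm (step k k∈α k≡uw w⇝v) = trans (along k≡uw) (monochromatic-Reach σ Tm w⇝v)
    where
    same : lookup σ (proj₁ (edge _ k)) ≡ lookup σ (proj₂ (edge _ k))
    same = to (monochromatic⇔ σ _) Tm k k∈α
    along : ∀ {u w} → edge _ k ≡ (u , w) ⊎ edge _ k ≡ (w , u) → lookup σ u ≡ lookup σ w
    along (inj₁ refl) = same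
    along (inj₂ refl) = sym same

  monochromatic≡constantOn : ∀ {α : EdgeSet n} {v} → Connected {n} α → v ∈ V {n} α → ∀ (σ : Vec (Fin m) n) →
    monochromatic σ α ≡ constantOn σ (V {n} α) (lookup σ v)
  monochromatic≡constantOn {n = n} {α = α} {v = v} connected v∈V σ = T-injective (mk⇔
    (λ Tm → from (constantOn⇔ σ (V α) _) (λ i i∈V → monochromatic-Reach σ Tm (connected i v i∈V v∈V)))
    (λ Tc → from (monochromatic⇔ σ α) (λ k k∈α →
      trans (to (constantOn⇔ σ (V α) _) Tc _ (endpoint∈V k∈α (inj₁ refl)))
            (sym (to (constantOn⇔ σ (V α) _) Tc _ (endpoint∈V k∈α (inj₂ refl)))))))

  Expect-mono-connected : ∀ m {α : EdgeSet n} {v} → Connected {n} α → v ∈ V {n} α →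
    Expect n (suc m) (mono {n} α) ≡ invPow (suc m) (∣ V {n} α ∣ ∸ 1)
  Expect-mono-connected {n} m {α} {v} connected v∈V = begin
    Expect n (suc m) (mono {n} α)
      ≡⟨ sumℚ-cong (λ σ → trans (sumℚ-cong (λ Y → *-assoc W (condProb σ Y) (mono {n} α Y)) (allGraphs n))
                                (sumℚ-*ˡ W (λ Y → condProb σ Y * mono {n} α Y) (allGraphs n))) Σs ⟩
    sumℚ (map (λ σ → W * sumℚ (map (λ Y → condProb σ Y * mono {n} α Y) (allGraphs n))) Σs)
      ≡⟨ sumℚ-cong (λ σ → cong (λ b → W * b) (trans (sumℚ-condProb-mono σ α)
                                                    (cong indicator (monochromatic≡constantOn connected v∈V σ)))) Σs ⟩
    sumℚ (map (λ σ → W * indicator (constantOn σ (V {n} α) (lookup σ v))) Σs)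
      ≡⟨ sumℚ-constantOn-at m (V {n} α) v∈V ⟩
    invPow (suc m) (∣ V {n} α ∣ ∸ 1) ∎
    where
    open ≡-Reasoning
    W : ℚ
    W = invPow (suc m) n
    Σs : List (Vec (Fin (suc m)) n)
    Σs = labellings n (suc m)

  1≤∣p∣⇒Nonempty : ∀ {p : Subset n} → 1 ℕ.≤ ∣ p ∣ → Nonempty p
  1≤∣p∣⇒Nonempty {n} {p} 1≤∣p∣ with nonempty? p
  ... | yes p≢∅ = p≢∅
  ... | no  p≡∅ = contradiction (subst (1 ℕ.≤_) (trans (cong ∣_∣ (Empty-unique p≡∅)) (∣⊥∣≡0 n)) 1≤∣p∣) λ ()

  V-nonempty : ∀ {α : EdgeSet n} → 1 ℕ.≤ ∣ α ∣ → Nonempty (V {n} α)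
  V-nonempty {α = α} 1≤∣α∣ with k , k∈α ← 1≤∣p∣⇒Nonempty {p = α} 1≤∣α∣ = _ , endpoint∈V {α = α} k∈α (inj₁ refl)

open import Data.Nat using (ℕ; _<_; _≤_; _∸_; _*_; suc; s≤s; z≤n)
open import Data.Fin.Subset using (∣_∣; _∈_)
open import Data.Product using (_×_; proj₁; proj₂)
open import Data.Integer using (+_)
open import Data.Rational as ℚ using (ℚ; 0ℚ; _-_; _/_)
open import Relation.Binary.PropositionalEquality using (subst₂; sym)
open RationalPowers using (invPow-sub-bounds)
open Moments using (Expect-mono-connected; V-nonempty; x∈p⇒∣p∣-nonZero)

lemma4p6 : (n q ℓ : ℕ) → 1 ≤ q → q < q Data.Nat.+ ℓ → q Data.Nat.+ ℓ ≤ n →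
    (α : EdgeSet n) → Connected {n} α → 1 ≤ ∣ α ∣ →
    (0ℚ ℚ.≤ (Expect n q (mono {n} α) - Expect n (q Data.Nat.+ ℓ) (mono {n} α)))
    × ((Expect n q (mono {n} α) - Expect n (q Data.Nat.+ ℓ) (mono {n} α))
        ℚ.≤ (+ (ℓ * (∣ V {n} α ∣ ∸ 1)) / 1) ℚ.* invPow q ∣ V {n} α ∣)
lemma4p6 n (suc q) ℓ (s≤s z≤n) _ _ α connected 1≤∣α∣ =
  subst₂ (λ x y → (0ℚ ℚ.≤ x - y) × (x - y ℚ.≤ (+ (ℓ * (∣ V {n} α ∣ ∸ 1)) / 1) ℚ.* invPow (suc q) ∣ V {n} α ∣))
    (sym (Expect-mono-connected q connected v∈V))
    (sym (Expect-mono-connected (q Data.Nat.+ ℓ) connected v∈V))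
    (invPow-sub-bounds q ℓ ∣ V {n} α ∣ {{x∈p⇒∣p∣-nonZero v∈V}})
  where
  v∈V : proj₁ (V-nonempty {α = α} 1≤∣α∣) ∈ V {n} α
  v∈V = proj₂ (V-nonempty {α = α} 1≤∣α∣)
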